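{- For every resolute social choice function $f:\mathcal L(A)^N\to A$ (with $N,A$ finite): (i) $f$ is strategy-proof iff $\mathfrak M_f,(R,R)\models\bigwedge_{i\in N}\neg\mu_{\{i\}}$ for every $R\in\mathcal L(A)^N$; (ii) $f$ is strongly group strategy-proof iff $\mathfrak M_f,(R,R)\models\bigwedge_{\varnothing\ne C\subseteq N}\neg\mu_C$ for every $R\in\mathcal L(A)^N$.
   Context: $\mathcal L(A)$ strict linear orders on $A$; $x\succ_i^R y$ means $x$ above $y$ in $R_i$, $x\succeq_i^R y$ means $x=y$ or $x\succ_i^Ry$; $Q\equiv_{ -C}P$ means $Q_j=P_j$ for $j\notin C$. $f$ is strategy-proof if for all $R$, $i$, and $Q_i\in\mathcal L(A)$, $f(R)\succeq_i^R f(Q_i,R_{ -i})$. $f$ is strongly group strategy-proof if there are no non-empty $C$, profile $R$, and $Q\equiv_{ -C}R$ with $f(Q)\succeq_i^Rf(R)$ for all $i\in C$ and $f(Q)\succ_j^R f(R)$ for some $j\in C$. Biprofile model $\mathfrak M_f$: states $(R,P)$; $(R,P)E_C(R',Q)$ iff $R'=R$ and $Q\equiv_{ -C}P$; $o_x$ true at $(R,P)$ iff $f(P)=x$; $p^i_{xy}$ true iff $x\succ_i^Ry$; $\langle C\rangle$ is the diamond of $E_C$. $\mathrm{Imp}_C(y,x)=\bigwedge_{i\in C}((y=x)\vee p^i_{yx})\wedge\bigvee_{i\in C}p^i_{yx}$; $\mu_C=\bigvee_{x,y\in A}(o_x\wedge\mathrm{Imp}_C(y,x)\wedge\langle C\rangle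 o_y)$. -}

module Defs where

open import Data.Nat using (ℕ)
open import Data.Fin using (Fin; _≟_)
open import Data.Fin.Subset using (Subset; _∈_; _∉_; ⁅_⁆; Nonempty; inside; outside)
open import Data.Vec using (Vec; lookup; _[_]≔_)
open import Data.List using (List; foldr; map; allFin)
open import Data.Bool using (Bool; T; true; false; if_then_else_)
open import Data.Sum using (_⊎_)
open import Data.Product using (_×_; _,_; Σ; ∃; ∃-syntax)
open import Data.Unit using (⊤)
open import Data.Empty using (⊥)
open import Relation.Nullary using (¬_; does)
open import Relation.Binary.PropositionalEquality using (_≡_; _≢_)

record LinOrd (m : ℕ) : Set where
  field
    _≻_    : Fin m → Fin m → Bool
    irrefl : ∀ x → ¬ T (x ≻ x)
    trans  : ∀ x y z → T (x ≻ y) → T (y ≻ z) → T (x ≻ z)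
    total  : ∀ x y → x ≢ y → T (x ≻ y) ⊎ T (y ≻ x)

-- Voters N = Fin n, alternatives A = Fin m. Profiles are vectors (so that
-- pointwise-equal profiles are equal without function extensionality).
Profile : ℕ → ℕ → Set
Profile n m = Vec (LinOrd m) n

SCF : ℕ → ℕ → Set
SCF n m = Profile n m → Fin m

module _ {n m : ℕ} where

  _≻[_,_]_ : Fin m → Profile n m → Fin n → Fin m → Set
  x ≻[ R , i ] y = T (LinOrd._≻_ (lookup R i) x y)

  _⪰[_,_]_ : Fin m → Profile n m → Fin n → Fin m → Set
  x ⪰[ R , i ] y = (x ≡ y) ⊎ (x ≻[ R , i ] y)

  _≡[-_]_ : Profile n m → Subset n → Profile n m → Set
  Q ≡[- C ] P = ∀ j → j ∉ C → lookup Q j ≡ lookup P j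

  update : Profile n m → Fin n → LinOrd m → Profile n m
  update R i Qi = R [ i ]≔ Qi

  StrategyProof : SCF n m → Set
  StrategyProof f = ∀ (R : Profile n m) (i : Fin n) (Qi : LinOrd m) →
                    f R ⪰[ R , i ] f (update R i Qi)

  StronglyGroupStrategyProof : SCF n m → Set
  StronglyGroupStrategyProof f =
    ¬ (Σ (Subset n) λ C → Nonempty C × Σ (Profile n m) λ R → Σ (Profile n m) λ Q →
         (Q ≡[- C ] R)
       × (∀ i → i ∈ C → f Q ⪰[ R , i ] f R)
       × (∃[ j ] (j ∈ C × f Q ≻[ R , j ] f R)))

  data Form : Set where
    ⊤f ⊥f : Form
    o     : Fin m → Form
    p     : Fin n → Fin m → Fin m → Form
    ¬f_   : Form → Form
    _∧f_  : Form → Form → Form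
    _∨f_  : Form → Form → Form
    ⟨_⟩_  : Subset n → Form → Form

  State : Set
  State = Profile n m × Profile n m

  E : Subset n → State → State → Set
  E C (R , P) (R' , Q) = (R' ≡ R) × (Q ≡[- C ] P)

  _,_⊨_ : SCF n m → State → Form → Set
  f , s ⊨ ⊤f = ⊤
  f , s ⊨ ⊥f = ⊥
  f , (R , P) ⊨ o x = f P ≡ x
  f , (R , P) ⊨ p i x y = x ≻[ R , i ] y
  f , s ⊨ (¬f φ) = ¬ (f , s ⊨ φ)
  f , s ⊨ (φ ∧f ψ) = (f , s ⊨ φ) × (f , s ⊨ ψ)
  f , s ⊨ (φ ∨f ψ) = (f , s ⊨ φ) ⊎ (f , s ⊨ ψ)
  f , s ⊨ (⟨ C ⟩ φ) = ∃[ s' ] (E C s s' × (f , s' ⊨ φ))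

  ⋀ : List Form → Form
  ⋀ = foldr _∧f_ ⊤f

  ⋁ : List Form → Form
  ⋁ = foldr _∨f_ ⊥f

  ⋀∈ : Subset n → (Fin n → Form) → Form
  ⋀∈ C φ = ⋀ (map (λ i → if lookup C i then φ i else ⊤f) (allFin n))

  ⋁∈ : Subset n → (Fin n → Form) → Form
  ⋁∈ C φ = ⋁ (map (λ i → if lookup C i then φ i else ⊥f) (allFin n))

  eqF : Fin m → Fin m → Form
  eqF y x = if does (y ≟ x) then ⊤f else ⊥f

  Imp : Subset n → Fin m → Fin m → Form
  Imp C y x = ⋀∈ C (λ i → eqF y x ∨f p i y x) ∧f ⋁∈ C (λ i → p i y x)

  μ : Subset n → Form
  μ C = ⋁ (map (λ x → ⋁ (map (λ y → o x ∧f (Imp C y x ∧f (⟨ C ⟩ o y))) (allFin m))) (allFin m))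

{-# OPTIONS --safe #-}
-- Unfolding the semantics, μ_C holds at (R , P) exactly when some Q that agrees with P
-- off C yields an outcome f Q that every member of C weakly prefers to f P under R, and
-- some member strictly prefers. At the truthful state (R , R) this is a profitable
-- manipulation by C, which is (ii). For C = {i} such a Q is R with only i's ballot
-- replaced, and since R_i is a linear order, "f R ⪰ᵢ f Q" is the same as "not f Q ≻ᵢ f R",
-- which is (i).
module Submission where

open import Defs
open import Data.Nat using (ℕ)
open import Data.Fin using (Fin; _≟_)
open import Data.Fin.Subset using (Subset; Nonempty; ⁅_⁆; _∈_)
open import Data.Fin.Subset.Properties using (x∈⁅x⁆; x∈⁅y⁆⇒x≡y; x≢y⇒x∉⁅y⁆; x∉⁅y⁆⇒x≢y)
open import Data.Product using (_×_; _,_; Σ; ∃-syntax)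
open import Data.Sum using (inj₁; inj₂)
open import Data.Unit using (tt)
open import Data.Bool using (true; false; if_then_else_)
open import Data.List using (List; []; _∷_; map; allFin)
open import Data.List.Relation.Unary.Any using (Any; here; there)
open import Data.List.Relation.Unary.All using (All; []; _∷_)
import Data.List.Relation.Unary.Any.Properties as Any
import Data.List.Relation.Unary.All.Properties as All
open import Data.Vec using (Vec; lookup; tabulate)
open import Data.Vec.Properties using ([]=⇒lookup; lookup⇒[]=; lookup∘update; lookup∘update′; tabulate∘lookup; tabulate-cong)
open import Relation.Nullary using (¬_; yes; no; contradiction; contraposition)
open import Relation.Binary.PropositionalEquality using (_≡_; refl; sym; trans; subst; subst₂; module ≡-Reasoning)
open import Function using (_∘_)
open import Function.Bundles using (_⇔_; mk⇔; Equivalence)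

open Equivalence using (to; from)

module _ {n m : ℕ} (f : SCF n m) (s : State {n} {m}) where

  ⊨⋁⇔Any : (φs : List (Form {n} {m})) → f , s ⊨ ⋁ φs ⇔ Any (f , s ⊨_) φs
  ⊨⋁⇔Any [] = mk⇔ (λ ()) (λ ())
  ⊨⋁⇔Any (φ ∷ φs) = mk⇔
    (λ { (inj₁ sat) → here sat ; (inj₂ sat) → there (to (⊨⋁⇔Any φs) sat) })
    (λ { (here sat) → inj₁ sat ; (there sat) → inj₂ (from (⊨⋁⇔Any φs) sat) })

  ⊨⋀⇔All : (φs : List (Form {n} {m})) → f , s ⊨ ⋀ φs ⇔ All (f , s ⊨_) φs
  ⊨⋀⇔All [] = mk⇔ (λ _ → []) (λ _ → tt)
  ⊨⋀⇔All (φ ∷ φs) = mk⇔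
    (λ (sat , sats) → sat ∷ to (⊨⋀⇔All φs) sats)
    (λ { (sat ∷ sats) → sat , from (⊨⋀⇔All φs) sats })

  ⊨⋁-allFin : ∀ {k} (φ : Fin k → Form) → f , s ⊨ ⋁ (map φ (allFin k)) ⇔ (∃[ x ] f , s ⊨ φ x)
  ⊨⋁-allFin φ = mk⇔
    (Any.tabulate⁻ ∘ Any.map⁻ ∘ to (⊨⋁⇔Any _))
    (λ (x , sat) → from (⊨⋁⇔Any _) (Any.map⁺ (Any.tabulate⁺ x sat)))

  ⊨⋀-allFin : ∀ {k} (φ : Fin k → Form) → f , s ⊨ ⋀ (map φ (allFin k)) ⇔ (∀ x → f , s ⊨ φ x)
  ⊨⋀-allFin φ = mk⇔
    (All.tabulate⁻ ∘ All.map⁻ ∘ to (⊨⋀⇔All _))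
    (from (⊨⋀⇔All _) ∘ All.map⁺ ∘ All.tabulate⁺)

  ⊨if-then-else-⊤ : ∀ b φ → f , s ⊨ (if b then φ else ⊤f) ⇔ (b ≡ true → f , s ⊨ φ)
  ⊨if-then-else-⊤ true  φ = mk⇔ (λ sat _ → sat) (λ sat → sat refl)
  ⊨if-then-else-⊤ false φ = mk⇔ (λ _ ()) (λ _ → tt)

  ⊨if-then-else-⊥ : ∀ b φ → f , s ⊨ (if b then φ else ⊥f) ⇔ (b ≡ true × f , s ⊨ φ)
  ⊨if-then-else-⊥ true  φ = mk⇔ (refl ,_) (λ (_ , sat) → sat)
  ⊨if-then-else-⊥ false φ = mk⇔ (λ ()) (λ ())

  ⊨⋀∈ : ∀ C φ → f , s ⊨ ⋀∈ C φ ⇔ (∀ i → i ∈ C → f , s ⊨ φ i)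
  ⊨⋀∈ C φ = mk⇔
    (λ sat i i∈C → to (⊨if-then-else-⊤ _ _) (to (⊨⋀-allFin _) sat i) ([]=⇒lookup i∈C))
    (λ sat → from (⊨⋀-allFin _) λ i →
      from (⊨if-then-else-⊤ _ _) (sat i ∘ lookup⇒[]= i C))

  ⊨⋁∈ : ∀ C φ → f , s ⊨ ⋁∈ C φ ⇔ (∃[ i ] (i ∈ C × f , s ⊨ φ i))
  ⊨⋁∈ C φ = mk⇔
    (λ sat → let i , sat′ = to (⊨⋁-allFin _) sat
                 C[i] , satφ = to (⊨if-then-else-⊥ _ _) sat′
             in i , lookup⇒[]= i C C[i] , satφ)
    (λ (i , i∈C , sat) → from (⊨⋁-allFin _) (i , from (⊨if-then-else-⊥ _ _) ([]=⇒lookup i∈C , sat)))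

  ⊨eqF : ∀ y x → f , s ⊨ eqF y x ⇔ y ≡ x
  ⊨eqF y x with y ≟ x
  ... | yes y≡x = mk⇔ (λ _ → y≡x) (λ _ → tt)
  ... | no  y≢x = mk⇔ (λ ()) y≢x

module _ {n m : ℕ} where

  Improvement : Profile n m → Subset n → Fin m → Fin m → Set
  Improvement R C y x = (∀ i → i ∈ C → y ⪰[ R , i ] x) × (∃[ j ] (j ∈ C × y ≻[ R , j ] x))

  ProfitableDeviation : SCF n m → Profile n m → Subset n → Profile n m → Set
  ProfitableDeviation f R C P = Σ (Profile n m) λ Q → (Q ≡[- C ] P) × Improvement R C (f Q) (f P)

  module _ (f : SCF n m) (R P : Profile n m) where

    ⊨Imp : ∀ C y x → f , (R , P) ⊨ Imp C y x ⇔ Improvement R C y x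
    ⊨Imp C y x = mk⇔
      (λ (weak , strict) →
          (λ i i∈C → to (⊨⪰ i) (to (⊨⋀∈ f _ C _) weak i i∈C)) , to (⊨⋁∈ f _ C _) strict)
      (λ (weak , strict) →
          from (⊨⋀∈ f _ C _) (λ i i∈C → from (⊨⪰ i) (weak i i∈C)) , from (⊨⋁∈ f _ C _) strict)
      where
      ⊨⪰ : ∀ i → f , (R , P) ⊨ (eqF y x ∨f p i y x) ⇔ y ⪰[ R , i ] x
      ⊨⪰ i = mk⇔
        (λ { (inj₁ sat) → inj₁ (to (⊨eqF f _ y x) sat) ; (inj₂ y≻x) → inj₂ y≻x })
        (λ { (inj₁ y≡x) → inj₁ (from (⊨eqF f _ y x) y≡x) ; (inj₂ y≻x) → inj₂ y≻x })

    ⊨μ : ∀ C → f , (R , P) ⊨ μ C ⇔ ProfitableDeviation f R C P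
    ⊨μ C = mk⇔
      (λ sat →
        let x , sat′ = to (⊨⋁-allFin f _ _) sat
            y , fP≡x , imp , (_ , Q) , (_ , Q≡P) , fQ≡y = to (⊨⋁-allFin f (R , P) (μ-disjunct x)) sat′
        in Q , Q≡P , subst₂ (Improvement R C) (sym fQ≡y) (sym fP≡x) (to (⊨Imp C y x) imp))
      (λ (Q , Q≡P , imp) →
        from (⊨⋁-allFin f _ _) (f P , from (⊨⋁-allFin f _ _)
          (f Q , refl , from (⊨Imp C (f Q) (f P)) imp , (R , Q) , (refl , Q≡P) , refl)))
      where
      μ-disjunct : Fin m → Fin m → Form
      μ-disjunct x y = o x ∧f (Imp C y x ∧f (⟨ C ⟩ o y))

    ⊨¬μ : ∀ C → f , (R , P) ⊨ (¬f μ C) ⇔ (¬ ProfitableDeviation f R C P)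
    ⊨¬μ C = mk⇔ (contraposition (from (⊨μ C))) (contraposition (to (⊨μ C)))

lookup-extensional : ∀ {A : Set} {k} (xs ys : Vec A k) → (∀ j → lookup xs j ≡ lookup ys j) → xs ≡ ys
lookup-extensional xs ys agree = begin
  xs                   ≡⟨ sym (tabulate∘lookup xs) ⟩
  tabulate (lookup xs) ≡⟨ tabulate-cong agree ⟩
  tabulate (lookup ys) ≡⟨ tabulate∘lookup ys ⟩
  ys                   ∎
  where open ≡-Reasoning

module _ {n m : ℕ} where

  update-≡[-⁅⁆] : ∀ (P : Profile n m) i Qi → update P i Qi ≡[- ⁅ i ⁆ ] P
  update-≡[-⁅⁆] P i Qi j j∉⁅i⁆ = lookup∘update′ (x∉⁅y⁆⇒x≢y j∉⁅i⁆) P Qi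

  ≡[-⁅⁆]⇒≡update : ∀ {Q P : Profile n m} {i} → Q ≡[- ⁅ i ⁆ ] P → Q ≡ update P i (lookup Q i)
  ≡[-⁅⁆]⇒≡update {Q} {P} {i} Q≡P = lookup-extensional Q (update P i (lookup Q i)) agree
    where
    agree : ∀ j → lookup Q j ≡ lookup (update P i (lookup Q i)) j
    agree j with j ≟ i
    ... | yes refl = sym (lookup∘update j P (lookup Q j))
    ... | no  j≢i  = trans (Q≡P j (x≢y⇒x∉⁅y⁆ j≢i)) (sym (lookup∘update′ j≢i P (lookup Q i)))

  module _ (R : Profile n m) (i : Fin n) where

    ⪰⇔⊀ : ∀ {x y} → x ⪰[ R , i ] y ⇔ (¬ y ≻[ R , i ] x)
    ⪰⇔⊀ {x} {y} = mk⇔ ⪰⇒⊀ ⊀⇒⪰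
      where
      open LinOrd (lookup R i) using (irrefl; total) renaming (trans to ≻-trans)
      ⪰⇒⊀ : x ⪰[ R , i ] y → ¬ y ≻[ R , i ] x
      ⪰⇒⊀ (inj₁ refl) y≻x = irrefl x y≻x
      ⪰⇒⊀ (inj₂ x≻y)  y≻x = irrefl x (≻-trans x y x x≻y y≻x)
      ⊀⇒⪰ : ¬ y ≻[ R , i ] x → x ⪰[ R , i ] y
      ⊀⇒⪰ y⊁x with x ≟ y
      ... | yes x≡y = inj₁ x≡y
      ... | no  x≢y with total x y x≢y
      ...   | inj₁ x≻y = inj₂ x≻y
      ...   | inj₂ y≻x = contradiction y≻x y⊁x

    improvement-⁅⁆ : ∀ {y x} → Improvement R ⁅ i ⁆ y x ⇔ y ≻[ R , i ] x
    improvement-⁅⁆ {y} {x} = mk⇔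
      (λ (_ , j , j∈⁅i⁆ , y≻x) → subst voter-prefers (x∈⁅y⁆⇒x≡y i j∈⁅i⁆) y≻x)
      (λ y≻x → (λ j j∈⁅i⁆ → inj₂ (subst voter-prefers (sym (x∈⁅y⁆⇒x≡y i j∈⁅i⁆)) y≻x))
             , i , x∈⁅x⁆ i , y≻x)
      where
      voter-prefers : Fin n → Set
      voter-prefers k = y ≻[ R , k ] x

    profitableDeviation-⁅⁆ : ∀ (f : SCF n m) P →
      ProfitableDeviation f R ⁅ i ⁆ P ⇔ (∃[ Qi ] f (update P i Qi) ≻[ R , i ] f P)
    profitableDeviation-⁅⁆ f P = mk⇔
      (λ (Q , Q≡P , imp) → lookup Q i
          , subst (λ Q′ → f Q′ ≻[ R , i ] f P) (≡[-⁅⁆]⇒≡update Q≡P) (to improvement-⁅⁆ imp))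
      (λ (Qi , gain) → update P i Qi , update-≡[-⁅⁆] P i Qi , from improvement-⁅⁆ gain)

  module _ (f : SCF n m) where

    strategyProof⇔noUnilateralDeviation :
      StrategyProof f ⇔ (∀ R i → ¬ ProfitableDeviation f R ⁅ i ⁆ R)
    strategyProof⇔noUnilateralDeviation = mk⇔
      (λ sp R i dev → let Qi , gain = to (profitableDeviation-⁅⁆ R i f R) dev
                      in to (⪰⇔⊀ R i) (sp R i Qi) gain)
      (λ noDev R i Qi → from (⪰⇔⊀ R i) λ gain →
                          noDev R i (from (profitableDeviation-⁅⁆ R i f R) (Qi , gain)))

    stronglyGroupStrategyProof⇔noCoalitionalDeviation :
      StronglyGroupStrategyProof f ⇔ (∀ R C → Nonempty C → ¬ ProfitableDeviation f R C R)
    stronglyGroupStrategyProof⇔noCoalitionalDeviation = mk⇔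
      (λ sgsp R C C≠∅ dev → sgsp (C , C≠∅ , R , dev))
      (λ noDev (C , C≠∅ , R , dev) → noDev R C C≠∅ dev)

theorem2 : ∀ {n m : ℕ} (f : SCF n m) →
    (StrategyProof f ⇔ (∀ (R : Profile n m) (i : Fin n) → f , (R , R) ⊨ (¬f μ ⁅ i ⁆)))
    × (StronglyGroupStrategyProof f ⇔
        (∀ (R : Profile n m) (C : Subset n) → Nonempty C → f , (R , R) ⊨ (¬f μ C)))
theorem2 f =
    mk⇔ (λ sp R i → from (⊨¬μ f R R ⁅ i ⁆) (to sp⇔ sp R i))
        (λ sat → from sp⇔ λ R i → to (⊨¬μ f R R ⁅ i ⁆) (sat R i))
  , mk⇔ (λ sgsp R C C≠∅ → from (⊨¬μ f R R C) (to sgsp⇔ sgsp R C C≠∅))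
        (λ sat → from sgsp⇔ λ R C C≠∅ → to (⊨¬μ f R R C) (sat R C C≠∅))
  where
  sp⇔ : StrategyProof f ⇔ (∀ R i → ¬ ProfitableDeviation f R ⁅ i ⁆ R)
  sp⇔ = strategyProof⇔noUnilateralDeviation f
  sgsp⇔ : StronglyGroupStrategyProof f ⇔ (∀ R C → Nonempty C → ¬ ProfitableDeviation f R C R)
  sgsp⇔ = stronglyGroupStrategyProof⇔noCoalitionalDeviation f
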